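{- For any string multiway system $M=(R,s,\Sigma)$ there is a string multiway system $M'=(R',s',\{a,b\})$, where $a,b$ are two distinct symbols, such that the states graphs of $M$ and $M'$ are isomorphic.
   Context: A (string) multiway system is a triple $(R,s,\Sigma)$ with $\Sigma$ a finite alphabet, $R$ a finite set of replacement rules $r\to t$ ($r,t\in\Sigma^*$) and initial string $s\in\Sigma^*$. Its states graph is the directed graph whose vertices are the strings reachable from $s$, with an edge $u\to v$ whenever $v$ is obtained from $u$ by replacing one occurrence of some $r$ by the corresponding $t$. -}

module Defs where

open import Level using (0ℓ)
open import Data.Nat using (ℕ)
open import Data.Fin using (Fin)
open import Data.List using (List; _++_)
open import Data.List.Membership.Propositional using (_∈_)
open import Data.Product using (Σ; ∃; ∃-syntax; _×_; _,_; proj₁)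
open import Relation.Binary.PropositionalEquality using (_≡_; refl; sym; trans)
open import Relation.Binary.Bundles using (Setoid)
open import Relation.Binary.Construct.Closure.ReflexiveTransitive using (Star)
open import Function.Bundles using (Inverse; _⇔_)

record MultiwaySystem (n : ℕ) : Set where
  constructor mws
  field
    rules   : List (List (Fin n) × List (Fin n))
    initial : List (Fin n)

open MultiwaySystem public

data Step {n : ℕ} (M : MultiwaySystem n) (u v : List (Fin n)) : Set where
  step : (x y r t : List (Fin n)) → (r , t) ∈ rules M →
         u ≡ x ++ r ++ y → v ≡ x ++ t ++ y → Step M u v

Reachable : {n : ℕ} → MultiwaySystem n → List (Fin n) → Set
Reachable M u = Star (Step M) (initial M) u

-- Vertices of the states graph, as a setoid: two vertices are equal
-- iff the underlying strings are equal (reachability proofs are irrelevant).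
Vertex : {n : ℕ} → MultiwaySystem n → Set
Vertex M = Σ (List _) (Reachable M)

VertexSetoid : {n : ℕ} → MultiwaySystem n → Setoid 0ℓ 0ℓ
VertexSetoid M = record
  { Carrier = Vertex M
  ; _≈_ = λ x y → proj₁ x ≡ proj₁ y
  ; isEquivalence = record { refl = refl ; sym = sym ; trans = trans }
  }

Edge : {n : ℕ} (M : MultiwaySystem n) → Vertex M → Vertex M → Set
Edge M x y = Step M (proj₁ x) (proj₁ y)

StatesGraphIso : {n m : ℕ} → MultiwaySystem n → MultiwaySystem m → Set
StatesGraphIso M M' =
  Σ (Inverse (VertexSetoid M) (VertexSetoid M')) λ φ →
    ∀ x y → Edge M x y ⇔ Edge M' (Inverse.to φ x) (Inverse.to φ y)

-- Encode the letter i as the block bⁱ⁺¹ and a word i₁ i₂ … as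
-- a bⁱ¹⁺¹ a bⁱ²⁺¹ a … a, and encode every rule letterwise.  The encoding of r
-- begins and ends with a delimiter a, so each of its occurrences inside the
-- encoding of u is aligned with the blocks and comes from an occurrence of r
-- in u.  Hence the encoding is an injection of strings mapping the steps of M
-- exactly onto the steps of the encoded system that start at encoded strings,
-- and such an injection induces an isomorphism of states graphs.
module Submission where

open import Defs
open import Data.Nat using (ℕ; zero; suc; pred)
open import Data.Fin using (Fin; toℕ)
open import Data.Fin.Properties using (toℕ-injective)
open import Data.List using (List; []; _∷_; _++_; [_]; replicate; map)
open import Data.List.Properties using (++-assoc; ++-identityʳ; ∷-injective; ∷-injectiveˡ; ∷-injectiveʳ)
open import Data.List.Membership.Propositional.Properties using (∈-map⁺; ∈-map⁻)
open import Data.Product using (∃; _×_; _,_; proj₁)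
open import Data.Sum using (_⊎_; inj₁; inj₂)
open import Function.Bundles using (Inverse; mk⇔)
open import Relation.Binary.PropositionalEquality using (_≡_; refl; sym; trans; cong; subst; module ≡-Reasoning)
open import Relation.Binary.Construct.Closure.ReflexiveTransitive using (Star; ε; _◅_; gmap)

module StringInjection {n m : ℕ} {M : MultiwaySystem n} {M' : MultiwaySystem m}
  (f : List (Fin n) → List (Fin m))
  (f-injective : ∀ {u v} → f u ≡ f v → u ≡ v)
  (f-initial : f (initial M) ≡ initial M')
  (f-step : ∀ {u v} → Step M u v → Step M' (f u) (f v))
  (f-step⁻ : ∀ {u w} → Step M' (f u) w → ∃ λ v → w ≡ f v × Step M u v)
  where

  f-star⁻ : ∀ {u w₁ w₂} → Star (Step M') w₁ w₂ → w₁ ≡ f u →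
            ∃ λ v → w₂ ≡ f v × Star (Step M) u v
  f-star⁻ {u} ε           eq   = u , eq , ε
  f-star⁻     (s ◅ steps) refl with f-step⁻ s
  ... | v , refl , s′ with f-star⁻ steps refl
  ...   | w , eq , steps′ = w , eq , s′ ◅ steps′

  to : Vertex M → Vertex M'
  to (u , reach) = f u , subst (λ w → Star (Step M') w (f u)) f-initial (gmap f f-step reach)

  from : Vertex M' → Vertex M
  from (w , reach) with f-star⁻ reach (sym f-initial)
  ... | u , _ , reach′ = u , reach′

  f∘from : ∀ x → proj₁ x ≡ f (proj₁ (from x))
  f∘from (w , reach) with f-star⁻ reach (sym f-initial)
  ... | _ , eq , _ = eq

  vertexInverse : Inverse (VertexSetoid M) (VertexSetoid M')
  vertexInverse = record
    { to        = to
    ; from      = from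
    ; to-cong   = cong f
    ; from-cong = λ {x} {y} eq → f-injective (trans (sym (f∘from x)) (trans eq (f∘from y)))
    ; inverse   = (λ {x} eq → trans (cong f eq) (sym (f∘from x)))
                , (λ {_} {y} eq → f-injective (trans (sym (f∘from y)) eq))
    }

  step-reflected : ∀ {u v} → Step M' (f u) (f v) → Step M u v
  step-reflected {u} s with v′ , eq , s′ ← f-step⁻ s = subst (Step M u) (sym (f-injective eq)) s′

  statesGraphIso : StatesGraphIso M M'
  statesGraphIso = vertexInverse , λ _ _ → mk⇔ f-step step-reflected

a b : Fin 2
a = Fin.zero
b = Fin.suc Fin.zero

module _ {n : ℕ} where

  block : Fin n → List (Fin 2)
  block c = replicate (suc (toℕ c)) b

  encodeʳ : List (Fin n) → List (Fin 2)
  encodeʳ []      = []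
  encodeʳ (c ∷ w) = block c ++ a ∷ encodeʳ w

  encodeˡ : List (Fin n) → List (Fin 2)
  encodeˡ []      = []
  encodeˡ (c ∷ w) = a ∷ block c ++ encodeˡ w

  encode : List (Fin n) → List (Fin 2)
  encode u = a ∷ encodeʳ u

  encodeʳ-++ : ∀ u w → encodeʳ (u ++ w) ≡ encodeʳ u ++ encodeʳ w
  encodeʳ-++ []      w = refl
  encodeʳ-++ (c ∷ u) w = begin
    block c ++ a ∷ encodeʳ (u ++ w)        ≡⟨ cong (λ z → block c ++ a ∷ z) (encodeʳ-++ u w) ⟩
    block c ++ a ∷ encodeʳ u ++ encodeʳ w  ≡⟨ ++-assoc (block c) (a ∷ encodeʳ u) (encodeʳ w) ⟨
    (block c ++ a ∷ encodeʳ u) ++ encodeʳ w ∎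
    where open ≡-Reasoning

  encode-++ : ∀ u w → encode (u ++ w) ≡ encodeˡ u ++ encode w
  encode-++ []      w = refl
  encode-++ (c ∷ u) w = cong (a ∷_) (begin
    block c ++ encode (u ++ w)          ≡⟨ cong (block c ++_) (encode-++ u w) ⟩
    block c ++ encodeˡ u ++ encode w    ≡⟨ ++-assoc (block c) (encodeˡ u) (encode w) ⟨
    (block c ++ encodeˡ u) ++ encode w  ∎)
    where open ≡-Reasoning

  encode-factor : ∀ x r y → encode (x ++ r ++ y) ≡ encodeˡ x ++ encode r ++ encodeʳ y
  encode-factor x r y = trans (encode-++ x (r ++ y)) (cong (λ z → encodeˡ x ++ a ∷ z) (encodeʳ-++ r y))

  runs-cancel : ∀ i j (p q : List (Fin 2)) →
                replicate i b ++ a ∷ p ≡ replicate j b ++ a ∷ q → i ≡ j × p ≡ q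
  runs-cancel zero    zero    p q eq = refl , ∷-injectiveʳ eq
  runs-cancel zero    (suc j) p q eq with () ← ∷-injectiveˡ eq
  runs-cancel (suc i) zero    p q eq with () ← ∷-injectiveˡ eq
  runs-cancel (suc i) (suc j) p q eq with runs-cancel i j p q (∷-injectiveʳ eq)
  ... | refl , p≡q = refl , p≡q

  block-cancel : ∀ c d (p q : List (Fin 2)) → block c ++ a ∷ p ≡ block d ++ a ∷ q → c ≡ d × p ≡ q
  block-cancel c d p q eq with runs-cancel (suc (toℕ c)) (suc (toℕ d)) p q eq
  ... | sizes , p≡q = toℕ-injective (cong pred sizes) , p≡q

  encodeʳ-injective : ∀ u v → encodeʳ u ≡ encodeʳ v → u ≡ v
  encodeʳ-injective []      []      eq = refl
  encodeʳ-injective (c ∷ u) (d ∷ v) eq with block-cancel c d _ _ eq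
  ... | refl , eq′ = cong (c ∷_) (encodeʳ-injective u v eq′)

  encode-injective : ∀ {u v} → encode u ≡ encode v → u ≡ v
  encode-injective {u} {v} eq = encodeʳ-injective u v (∷-injectiveʳ eq)

  locate-a : ∀ i (p w q : List (Fin 2)) → replicate i b ++ a ∷ p ≡ w ++ a ∷ q →
             (w ≡ replicate i b × p ≡ q) ⊎
             (∃ λ w′ → w ≡ replicate i b ++ a ∷ w′ × p ≡ w′ ++ a ∷ q)
  locate-a zero    p []      q eq = inj₁ (refl , ∷-injectiveʳ eq)
  locate-a zero    p (_ ∷ w) q eq with refl , eq′ ← ∷-injective eq = inj₂ (w , refl , eq′)
  locate-a (suc i) p []      q eq with () ← ∷-injectiveˡ eq
  locate-a (suc i) p (_ ∷ w) q eq with refl , eq′ ← ∷-injective eq | locate-a i p w q eq′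
  ... | inj₁ (refl , p≡q)       = inj₁ (refl , p≡q)
  ... | inj₂ (w′ , refl , p≡w′) = inj₂ (w′ , refl , p≡w′)

  encodeʳ-prefix : ∀ u r y → encodeʳ u ≡ encodeʳ r ++ y → ∃ λ y′ → u ≡ r ++ y′ × y ≡ encodeʳ y′
  encodeʳ-prefix u       []      y eq = u , refl , sym eq
  encodeʳ-prefix (d ∷ u) (c ∷ r) y eq
    with refl , eq′ ← block-cancel d c _ _ (trans eq (++-assoc (block c) (a ∷ encodeʳ r) y))
    with y′ , refl , y≡ ← encodeʳ-prefix u r y eq′ = y′ , refl , y≡

  -- An occurrence of an encoded word r in the encoding of u, read back in u.
  data Occurrence (r : List (Fin n)) : List (Fin n) → List (Fin 2) → List (Fin 2) → Set where
    occurrence : ∀ x y → Occurrence r (x ++ r ++ y) (encodeˡ x) (encodeʳ y)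

  occurrence-∷ : ∀ {r u x y} c → Occurrence r u x y → Occurrence r (c ∷ u) (a ∷ block c ++ x) y
  occurrence-∷ c (occurrence x y) = occurrence (c ∷ x) y

  occurrence-inner : ∀ u r w y → encodeʳ u ≡ w ++ a ∷ encodeʳ r ++ y → Occurrence r u (a ∷ w) y
  occurrence-inner []      r []      y ()
  occurrence-inner []      r (_ ∷ _) y ()
  occurrence-inner (d ∷ u) r w y eq with locate-a (suc (toℕ d)) (encodeʳ u) w (encodeʳ r ++ y) eq
  ... | inj₁ (refl , eq′) with y′ , refl , refl ← encodeʳ-prefix u r y eq′ =
    subst (λ z → Occurrence r (d ∷ r ++ y′) z (encodeʳ y′))
          (cong (a ∷_) (++-identityʳ (block d))) (occurrence [ d ] y′)
  ... | inj₂ (w′ , refl , eq′) = occurrence-∷ d (occurrence-inner u r w′ y eq′)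

  occurrence-encode : ∀ u r x y → encode u ≡ x ++ encode r ++ y → Occurrence r u x y
  occurrence-encode u r [] y eq with y′ , refl , refl ← encodeʳ-prefix u r y (∷-injectiveʳ eq) =
    occurrence [] y′
  occurrence-encode u r (_ ∷ w) y eq with refl , eq′ ← ∷-injective eq =
    occurrence-inner u r w y eq′

module _ {n : ℕ} (M : MultiwaySystem n) where

  encodeRule : List (Fin n) × List (Fin n) → List (Fin 2) × List (Fin 2)
  encodeRule (r , t) = encode r , encode t

  encodeSystem : MultiwaySystem 2
  encodeSystem = mws (map encodeRule (rules M)) (encode (initial M))

  encode-step : ∀ {u v} → Step M u v → Step encodeSystem (encode u) (encode v)
  encode-step (step x y r t rule refl refl) =
    step (encodeˡ x) (encodeʳ y) (encode r) (encode t) (∈-map⁺ encodeRule rule)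
         (encode-factor x r y) (encode-factor x t y)

  encode-step⁻ : ∀ {u w} → Step encodeSystem (encode u) w → ∃ λ v → w ≡ encode v × Step M u v
  encode-step⁻ {u} (step x y _ _ rule′ eq₁ eq₂) with (r , t) , rule , refl ← ∈-map⁻ encodeRule rule′
    with occurrence x′ y′ ← occurrence-encode u r x y eq₁ =
    x′ ++ t ++ y′ , trans eq₂ (sym (encode-factor x′ t y′)) , step x′ y′ r t rule refl refl

lemma4 : (n : ℕ) (M : MultiwaySystem n) →
    ∃ λ (M' : MultiwaySystem 2) → StatesGraphIso M M'
lemma4 n M = encodeSystem M , StringInjection.statesGraphIso encode encode-injective refl
                                (encode-step M) (encode-step⁻ M)
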